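{- Every near-comparability graph is permissible.
   Context: Graphs are finite and simple. The MIS network of $G=(V,E)$ is $F_G(x)_v=\bigwedge_{u\in N(v)}\neg x_u$ for $x\in\{0,1\}^V$ (value $1$ if $v$ has no neighbours); $F_G^v$ updates only coordinate $v$; for a word $w=w_1\dots w_l$, $F_G^w=F_G^{w_l}\circ\dots\circ F_G^{w_1}$. A permis of $G$ is a permutation $w$ of $V$ such that $F_G^w(x)$ is the characteristic vector of a maximal independent set of $G$ for every $x\in\{0,1\}^V$; $G$ is permissible if it has a permis. In an orientation $H$ of $G$ (each edge given one direction), a vertex $t$ is transitive if for all $a,b$, $t\to a\to b$ implies $t\to b$; a vertex $v$ is near-transitive if there is a transitive vertex $t$ with $N[t]\subseteq N[v]$, where $N[\cdot]$ is the closed neighbourhood in $G$. A near-comparability graph is a graph admitting an orientation in which every vertex is near-transitive. -}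

module Defs where

open import Data.Nat using (ℕ)
open import Data.Fin using (Fin; _≟_)
open import Data.Bool using (Bool; true; false; not; _∧_; if_then_else_)
open import Data.List using (List; []; _∷_; allFin; map)
open import Data.Bool.ListAction using (and)
open import Data.List.Relation.Binary.Permutation.Propositional using (_↭_)
open import Data.Product using (Σ; _×_; ∃; ∃-syntax)
open import Data.Sum using (_⊎_)
open import Relation.Nullary using (¬_; does)
open import Relation.Binary.PropositionalEquality using (_≡_)

record Graph : Set where
  field
    n     : ℕ
    E     : Fin n → Fin n → Bool
    sym   : ∀ u v → E u v ≡ E v u
    irref : ∀ v → E v v ≡ false
open Graph public

Config : Graph → Set
Config G = Fin (n G) → Bool

F : (G : Graph) → Config G → Config G
F G x v = and (map (λ u → if E G v u then not (x u) else true) (allFin (n G)))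

Fv : (G : Graph) → Fin (n G) → Config G → Config G
Fv G v x u = if does (u ≟ v) then F G x v else x u

-- F^w = F^{w_l} ∘ … ∘ F^{w_1}  (w_1 applied first)
Fw : (G : Graph) → List (Fin (n G)) → Config G → Config G
Fw G []      x = x
Fw G (v ∷ w) x = Fw G w (Fv G v x)

Independent : (G : Graph) → Config G → Set
Independent G x = ∀ u v → E G u v ≡ true → ¬ (x u ≡ true × x v ≡ true)

IsMIS : (G : Graph) → Config G → Set
IsMIS G x = Independent G x ×
  (∀ (y : Config G) → Independent G y → (∀ v → x v ≡ true → y v ≡ true)
     → ∀ v → y v ≡ true → x v ≡ true)

IsPermis : (G : Graph) → List (Fin (n G)) → Set
IsPermis G w = (w ↭ allFin (n G)) × (∀ (x : Config G) → IsMIS G (Fw G w x))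

Permissible : Graph → Set
Permissible G = ∃[ w ] IsPermis G w

record Orientation (G : Graph) : Set where
  field
    Arc     : Fin (n G) → Fin (n G) → Bool
    onEdges : ∀ u v → Arc u v ≡ true → E G u v ≡ true
    covers  : ∀ u v → E G u v ≡ true → Arc u v ≡ true ⊎ Arc v u ≡ true
    antisym : ∀ u v → Arc u v ≡ true → ¬ (Arc v u ≡ true)
open Orientation public

_∈N[_] : {G : Graph} → Fin (n G) → Fin (n G) → Set
_∈N[_] {G} u v = u ≡ v ⊎ E G v u ≡ true

Transitive : (G : Graph) → Orientation G → Fin (n G) → Set
Transitive G H t = ∀ a b → Arc H t a ≡ true → Arc H a b ≡ true → Arc H t b ≡ true

NearTransitive : (G : Graph) → Orientation G → Fin (n G) → Set
NearTransitive G H v =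
  ∃[ t ] (Transitive G H t × (∀ u → _∈N[_] {G} u t → _∈N[_] {G} u v))

NearComparability : Graph → Set
NearComparability G = ∃[ H ] (∀ v → NearTransitive G H v)

-- Update the non-transitive vertices first and then the transitive ones by decreasing
-- out-degree. Any sequential update along a permutation yields an independent set, since
-- a vertex updated after an occupied neighbour switches off. For maximality it suffices,
-- by near-transitivity, that the closed neighbourhood N[t] of every transitive vertex t
-- ends up containing an occupied vertex. If it does not, t was switched off by a
-- neighbour u that was occupied at the time; u cannot precede t (it would stay
-- occupied), so u is transitive and initially occupied, and t → u because an arc u → t
-- would give outdeg t < outdeg u. The same reasoning at u produces a later, initially
-- occupied r with u → r, hence t → r, and outdeg r < outdeg u. Out-degrees cannot
-- decrease forever.

module Submission where

open import Defs

open import Data.Bool using (Bool; true; false; not; T; T?; if_then_else_)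
open import Data.Bool.Properties using (T-≡; T-not-≡; not-¬) renaming (_≟_ to _≟ᵇ_)
open import Data.Empty using (⊥-elim)
open import Data.Fin using (Fin; _≟_)
open import Data.Fin.Properties using (all?)
open import Data.Fin.Subset as Subset using (Subset; ∣_∣)
open import Data.Fin.Subset.Properties using (p⊂q⇒∣p∣<∣q∣; ∣⊤∣≡n; ∈⊤; ⊆⊤)
open import Data.List using (List; []; _∷_; allFin)
open import Data.List.Membership.Propositional using (_∈_)
open import Data.List.Membership.Propositional.Properties using (∈-allFin)
open import Data.List.Relation.Binary.Permutation.Propositional using (_↭_; ↭-sym; ↭⇒↭ₛ)
open import Data.List.Relation.Binary.Permutation.Propositional.Properties using (∈-resp-↭)
import Data.List.Relation.Binary.Permutation.Setoid.Properties as Permutationₛ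
open import Data.List.Relation.Unary.All as All using (All; []; _∷_)
open import Data.List.Relation.Unary.All.Properties using (all⁺; all⁻; ¬All⇒Any¬)
open import Data.List.Relation.Unary.AllPairs using (AllPairs; _∷_)
open import Data.List.Relation.Unary.Any using (here; there; satisfied)
open import Data.List.Relation.Unary.Linked.Properties using (Linked⇒AllPairs)
open import Data.List.Relation.Unary.Unique.Propositional using (Unique)
open import Data.List.Relation.Unary.Unique.Propositional.Properties using (allFin⁺)
import Data.List.Sort as Sort
open import Data.Nat using (ℕ; suc; _≤_; _<_; s≤s)
open import Data.Nat.Induction using (<-wellFounded)
open import Data.Nat.Properties using (≤-decTotalOrder; <-cmp; <⇒≱; n≮0; suc-injective; 0≢1+n)
open import Data.Product using (_×_; _,_; ∃-syntax; swap)
open import Data.Sum using (_⊎_; inj₁; inj₂)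
open import Data.Vec using (tabulate)
open import Data.Vec.Properties using (lookup∘tabulate; lookup⇒[]=; []=⇒lookup)
open import Function using (_∘_; Equivalence)
open import Induction.WellFounded using (Acc; acc)
open import Relation.Binary using (DecTotalOrder; DecidableEquality; tri<; tri≈; tri>)
import Relation.Binary.Construct.Flip.EqAndOrd as Flip
import Relation.Binary.Construct.On as On
open import Relation.Binary.PropositionalEquality as ≡
  using (_≡_; _≢_; refl; subst; subst₂; setoid)
open import Relation.Nullary using (¬_; Dec; yes; no)
open import Relation.Nullary.Decidable using (_→-dec_)

open Equivalence using (to; from)

module _ (G : Graph) where

  private
    V = Fin (n G)

    clear : Config G → V → V → Bool
    clear x v u = if E G v u then not (x u) else true

  F≡true⇒neighbour-free : ∀ {x v u} → F G x v ≡ true → E G v u ≡ true → x u ≡ false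
  F≡true⇒neighbour-free {x} {v} {u} Fxv Evu =
    T-not-≡ .to (subst (λ b → T (if b then not (x u) else true)) Evu
      (All.lookup (all⁺ (clear x v) (allFin (n G)) (T-≡ .from Fxv)) (∈-allFin u)))

  F≡false⇒neighbour-occupied : ∀ {x v} → F G x v ≡ false →
                               ∃[ u ] (E G v u ≡ true × x u ≡ true)
  F≡false⇒neighbour-occupied {x} {v} Fxv =
    let u , ¬clear = satisfied (¬All⇒Any¬ (T? ∘ clear x v) _ notAll) in u , occupied u ¬clear
    where
    occupied : ∀ u → ¬ T (clear x v u) → E G v u ≡ true × x u ≡ true
    occupied u ¬clear with E G v u | x u
    ... | true  | true  = refl , refl
    ... | true  | false = ⊥-elim (¬clear _)
    ... | false | _     = ⊥-elim (¬clear _)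

    notAll : ¬ All (T ∘ clear x v) (allFin (n G))
    notAll = subst T Fxv ∘ all⁻ (clear x v)

Vacant : (G : Graph) → Config G → Fin (n G) → Set
Vacant G y v = ∀ s → _∈N[_] {G} s v → y s ≡ false

Maximal : (G : Graph) → Config G → Set
Maximal G x = ∀ (y : Config G) → Independent G y → (∀ v → x v ≡ true → y v ≡ true)
  → ∀ v → y v ≡ true → x v ≡ true

nowhere-vacant⇒maximal : ∀ G y → (∀ v → ¬ Vacant G y v) → Maximal G y
nowhere-vacant⇒maximal G y nowhere-vacant y′ y′-indep y⊆y′ v y′v with y v in yv
... | true  = refl
... | false = ⊥-elim (nowhere-vacant v vacant)
  where
  vacant : Vacant G y v
  vacant s s∈N[v] with y s in ys | s∈N[v]
  ... | false | _         = refl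
  ... | true  | inj₁ refl = ⊥-elim (not-¬ ys yv)
  ... | true  | inj₂ Evs  = ⊥-elim (y′-indep v s Evs (y′v , y⊆y′ s ys))

module Position {A : Set} (_≟ᴬ_ : DecidableEquality A) where

  pos : List A → A → ℕ
  pos []      u = 0
  pos (a ∷ w) u with a ≟ᴬ u
  ... | yes _ = 0
  ... | no  _ = suc (pos w u)

  pos-injective : ∀ {w u v} → u ∈ w → v ∈ w → pos w u ≡ pos w v → u ≡ v
  pos-injective {a ∷ w} {u} {v} u∈ v∈ eq with a ≟ᴬ u | a ≟ᴬ v
  ... | yes refl | yes refl = refl
  ... | yes _    | no  _    = ⊥-elim (0≢1+n eq)
  ... | no  _    | yes _    = ⊥-elim (0≢1+n (≡.sym eq))
  ... | no  a≢u  | no  a≢v with u∈ | v∈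
  ...   | here refl | _         = ⊥-elim (a≢u refl)
  ...   | there _   | here refl = ⊥-elim (a≢v refl)
  ...   | there u∈w | there v∈w = pos-injective u∈w v∈w (suc-injective eq)

  AllPairs-pos< : ∀ {R : A → A → Set} {w u v} →
                  AllPairs R w → u ∈ w → v ∈ w → pos w u < pos w v → R u v
  AllPairs-pos< {w = a ∷ w} {u} {v} (Ra ∷ Rw) u∈ v∈ lt with a ≟ᴬ u | a ≟ᴬ v
  ... | _        | yes _   = ⊥-elim (n≮0 lt)
  ... | yes refl | no  a≢v with v∈
  ...   | here refl = ⊥-elim (a≢v refl)
  ...   | there v∈w = All.lookup Ra v∈w
  AllPairs-pos< (_ ∷ Rw) u∈ v∈ lt | no a≢u | no a≢v with u∈ | v∈ | lt
  ... | here refl | _         | _       = ⊥-elim (a≢u refl)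
  ... | there _   | here refl | _       = ⊥-elim (a≢v refl)
  ... | there u∈w | there v∈w | s≤s lt′ = AllPairs-pos< Rw u∈w v∈w lt′

module Updates (G : Graph) where

  private
    V = Fin (n G)

  open Position (_≟_ {n G}) public

  Fv-self : ∀ v x → Fv G v x v ≡ F G x v
  Fv-self v x with v ≟ v
  ... | yes _   = refl
  ... | no  v≢v = ⊥-elim (v≢v refl)

  Fv-other : ∀ {v u} x → u ≢ v → Fv G v x u ≡ x u
  Fv-other {v} {u} x u≢v with u ≟ v
  ... | yes u≡v = ⊥-elim (u≢v u≡v)
  ... | no  _   = refl

  Fw-other : ∀ {u} w x → All (u ≢_) w → Fw G w x u ≡ x u
  Fw-other []      x []           = refl
  Fw-other (a ∷ w) x (u≢a ∷ u∉w) = ≡.trans (Fw-other w (Fv G a x) u∉w) (Fv-other x u≢a)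

  stateBefore : List V → Config G → V → Config G
  stateBefore []      x v = x
  stateBefore (a ∷ w) x v with a ≟ v
  ... | yes _ = x
  ... | no  _ = stateBefore w (Fv G a x) v

  Fw-at : ∀ {w v} x → Unique w → v ∈ w → Fw G w x v ≡ F G (stateBefore w x v) v
  Fw-at {a ∷ w} {v} x (a∉w ∷ _) v∈ with a ≟ v
  ... | yes refl = ≡.trans (Fw-other w (Fv G a x) a∉w) (Fv-self a x)
  Fw-at x (_ ∷ uw) (here refl)  | no a≢v = ⊥-elim (a≢v refl)
  Fw-at x (_ ∷ uw) (there v∈w)  | no _   = Fw-at (Fv G _ x) uw v∈w

  stateBefore-other : ∀ {u} w x v → All (u ≢_) w → stateBefore w x v u ≡ x u
  stateBefore-other []      x v _            = refl
  stateBefore-other (a ∷ w) x v (u≢a ∷ u∉w) with a ≟ v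
  ... | yes _ = refl
  ... | no  _ = ≡.trans (stateBefore-other w (Fv G a x) v u∉w) (Fv-other x u≢a)

  stateBefore-earlier : ∀ w {u v} x → Unique w → pos w u < pos w v →
                        stateBefore w x v u ≡ Fw G w x u
  stateBefore-earlier (a ∷ w) {u} {v} x (a∉w ∷ uw) lt with a ≟ v | a ≟ u
  ... | yes _    | _      = ⊥-elim (n≮0 lt)
  ... | no  _    | yes refl =
    ≡.trans (stateBefore-other w (Fv G a x) v a∉w) (≡.sym (Fw-other w (Fv G a x) a∉w))
  ... | no  _    | no  _  with lt
  ...   | s≤s lt′ = stateBefore-earlier w (Fv G a x) uw lt′

  stateBefore-later : ∀ w {u v} x → pos w v < pos w u → stateBefore w x v u ≡ x u
  stateBefore-later (a ∷ w) {u} {v} x lt with a ≟ v | a ≟ u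
  ... | yes _ | _      = refl
  ... | no  _ | yes _  = ⊥-elim (n≮0 lt)
  ... | no  _ | no a≢u with lt
  ...   | s≤s lt′ = ≡.trans (stateBefore-later w (Fv G a x) lt′) (Fv-other x (a≢u ∘ ≡.sym))

  Fw-earlier-neighbour-excludes : ∀ {w u v} x → Unique w → v ∈ w → pos w u < pos w v →
                                  E G v u ≡ true → ¬ (Fw G w x u ≡ true × Fw G w x v ≡ true)
  Fw-earlier-neighbour-excludes x uw v∈ u<v Evu (yu , yv) =
    not-¬ (≡.trans (stateBefore-earlier _ x uw u<v) yu)
          (F≡true⇒neighbour-free G (≡.trans (≡.sym (Fw-at x uw v∈)) yv) Evu)

  Fw-independent : ∀ {w} x → Unique w → (∀ v → v ∈ w) → Independent G (Fw G w x)
  Fw-independent {w} x uw cover u v Euv with <-cmp (pos w u) (pos w v)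
  ... | tri< u<v _ _ = Fw-earlier-neighbour-excludes x uw (cover v) u<v (≡.trans (sym G v u) Euv)
  ... | tri> _ _ v<u = Fw-earlier-neighbour-excludes x uw (cover u) v<u Euv ∘ swap
  ... | tri≈ _ u≈v _ with pos-injective (cover u) (cover v) u≈v
  ...   | refl = λ _ → not-¬ Euv (irref G u)

module Ranking (G : Graph) (H : Orientation G) where

  private
    V = Fin (n G)

  out : V → Subset (n G)
  out v = tabulate (Arc H v)

  ∈out⁺ : ∀ {v u} → Arc H v u ≡ true → u Subset.∈ out v
  ∈out⁺ {v} {u} a = lookup⇒[]= u (out v) (≡.trans (lookup∘tabulate (Arc H v) u) a)

  ∈out⁻ : ∀ {v u} → u Subset.∈ out v → Arc H v u ≡ true
  ∈out⁻ {v} {u} u∈ = ≡.trans (≡.sym (lookup∘tabulate (Arc H v) u)) ([]=⇒lookup u∈)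

  ∉out-self : ∀ v → v Subset.∉ out v
  ∉out-self v v∈ = antisym H v v (∈out⁻ v∈) (∈out⁻ v∈)

  outdeg : V → ℕ
  outdeg v = ∣ out v ∣

  outdeg<n : ∀ v → outdeg v < n G
  outdeg<n v =
    subst (outdeg v <_) (∣⊤∣≡n (n G)) (p⊂q⇒∣p∣<∣q∣ (⊆⊤ , v , ∈⊤ , ∉out-self v))

  transitive-arc⇒outdeg< : ∀ {t u} → Transitive G H t → Arc H t u ≡ true →
                           outdeg u < outdeg t
  transitive-arc⇒outdeg< {t} {u} t-trans tu = p⊂q⇒∣p∣<∣q∣ (out-u⊆out-t , u , ∈out⁺ tu , ∉out-self u)
    where
    out-u⊆out-t : out u Subset.⊆ out t
    out-u⊆out-t b∈ = ∈out⁺ (t-trans u _ tu (∈out⁻ b∈))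

  transitive? : ∀ t → Dec (Transitive G H t)
  transitive? t = all? λ a → all? λ b →
    (Arc H t a ≟ᵇ true) →-dec (Arc H a b ≟ᵇ true) →-dec (Arc H t b ≟ᵇ true)

  rank : V → ℕ
  rank v with transitive? v
  ... | yes _ = outdeg v
  ... | no  _ = n G

  rank-transitive : ∀ {t} → Transitive G H t → rank t ≡ outdeg t
  rank-transitive {t} t-trans with transitive? t
  ... | yes _       = refl
  ... | no  ¬t-trans = ⊥-elim (¬t-trans t-trans)

  rank≤transitive⇒transitive : ∀ {t u} → Transitive G H t → rank u ≤ rank t →
                               Transitive G H u
  rank≤transitive⇒transitive {t} {u} t-trans u≤t with transitive? u
  ... | yes u-trans = u-trans
  ... | no  _       = ⊥-elim (<⇒≱ (outdeg<n t) (subst (n G ≤_) (rank-transitive t-trans) u≤t))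

  rank≤transitive⇒no-arc : ∀ {t u} → Transitive G H t → rank u ≤ rank t →
                           ¬ (Arc H u t ≡ true)
  rank≤transitive⇒no-arc {t} {u} t-trans u≤t ut =
    <⇒≱ (transitive-arc⇒outdeg< u-trans ut)
      (subst₂ _≤_ (rank-transitive u-trans) (rank-transitive t-trans) u≤t)
    where u-trans = rank≤transitive⇒transitive t-trans u≤t

  byDecreasingRank : DecTotalOrder _ _ _
  byDecreasingRank = On.decTotalOrder (Flip.decTotalOrder ≤-decTotalOrder) rank

  open Sort byDecreasingRank using (sort; sort-↭; sort-↗)
  open Updates G

  word : List V
  word = sort (allFin (n G))

  word-↭ : word ↭ allFin (n G)
  word-↭ = sort-↭ (allFin (n G))

  word-unique : Unique word
  word-unique =
    Permutationₛ.Unique-resp-↭ (setoid V) (↭⇒↭ₛ (↭-sym word-↭)) (allFin⁺ (n G))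

  ∈-word : ∀ v → v ∈ word
  ∈-word v = ∈-resp-↭ (↭-sym word-↭) (∈-allFin v)

  rank-antitone : ∀ {u v} → pos word u < pos word v → rank v ≤ rank u
  rank-antitone = AllPairs-pos< word-sorted (∈-word _) (∈-word _)
    where
    word-sorted : AllPairs (λ u v → rank v ≤ rank u) word
    word-sorted = Linked⇒AllPairs (DecTotalOrder.trans byDecreasingRank) (sort-↗ _)

module Domination (G : Graph) (H : Orientation G) (x : Config G) where

  open Ranking G H
  open Updates G

  private
    V = Fin (n G)

  y : Config G
  y = Fw G word x

  _≺_ : V → V → Set
  u ≺ v = pos word u < pos word v

  before : V → Config G
  before = stateBefore word x

  before-earlier : ∀ {u v} → u ≺ v → before v u ≡ y u
  before-earlier = stateBefore-earlier word x word-unique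

  before-later : ∀ {u v} → v ≺ u → before v u ≡ x u
  before-later = stateBefore-later word x

  occupied⇒neighbour-free-before : ∀ {v u} → y v ≡ true → E G v u ≡ true → before v u ≡ false
  occupied⇒neighbour-free-before {v} yv =
    F≡true⇒neighbour-free G (≡.trans (≡.sym (Fw-at x word-unique (∈-word v))) yv)

  vacant⇒neighbour-occupied-before : ∀ {v} → y v ≡ false →
                                     ∃[ u ] (E G v u ≡ true × before v u ≡ true)
  vacant⇒neighbour-occupied-before {v} yv =
    F≡false⇒neighbour-occupied G (≡.trans (≡.sym (Fw-at x word-unique (∈-word v))) yv)

  module _ {t} (t-trans : Transitive G H t) (t-vacant : Vacant G y t) where

    Reached : V → Set
    Reached u = u ≡ t ⊎ (Arc H t u ≡ true × x u ≡ true)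

    reached-arc : ∀ {u r} → Reached u → Arc H u r ≡ true → Arc H t r ≡ true
    reached-arc (inj₁ refl)     ur = ur
    reached-arc (inj₂ (tu , _)) ur = t-trans _ _ tu ur

    reached-vacant : ∀ {u} → Reached u → y u ≡ false
    reached-vacant (inj₁ refl)     = t-vacant _ (inj₁ refl)
    reached-vacant (inj₂ (tu , _)) = t-vacant _ (inj₂ (onEdges H _ _ tu))

    earlier-neighbour-vacant : ∀ {u r} → Reached u → r ≺ u → E G u r ≡ true → ¬ (y r ≡ true)
    earlier-neighbour-vacant (inj₁ refl) r≺t Etr yr = not-¬ yr (t-vacant _ (inj₂ Etr))
    earlier-neighbour-vacant {u} {r} (inj₂ (tu , xu)) r≺u Eur yr with covers H u r Eur
    ... | inj₁ ur = not-¬ yr (t-vacant r (inj₂ (onEdges H t r (t-trans u r tu ur))))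
    ... | inj₂ ru = not-¬ (≡.trans (before-later r≺u) xu)
                          (occupied⇒neighbour-free-before yr (onEdges H r u ru))

    later-neighbour-reached : ∀ {u r} → Transitive G H u → Reached u → u ≺ r →
                              E G u r ≡ true → before u r ≡ true →
                              Transitive G H r × Reached r × outdeg r < outdeg u
    later-neighbour-reached {u} {r} u-trans reached u≺r Eur before-u-r with covers H u r Eur
    ... | inj₂ ru = ⊥-elim (rank≤transitive⇒no-arc u-trans (rank-antitone u≺r) ru)
    ... | inj₁ ur = rank≤transitive⇒transitive u-trans (rank-antitone u≺r)
                  , inj₂ (reached-arc reached ur , ≡.trans (≡.sym (before-later u≺r)) before-u-r)
                  , transitive-arc⇒outdeg< u-trans ur

    climb : ∀ u → Acc _<_ (outdeg u) → Transitive G H u → ¬ Reached u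
    climb u (acc smaller) u-trans reached
      with vacant⇒neighbour-occupied-before (reached-vacant reached)
    ... | r , Eur , before-u-r with <-cmp (pos word r) (pos word u)
    ...   | tri< r≺u _ _ =
      earlier-neighbour-vacant reached r≺u Eur (≡.trans (≡.sym (before-earlier r≺u)) before-u-r)
    ...   | tri> _ _ u≺r =
      let r-trans , r-reached , r<u = later-neighbour-reached u-trans reached u≺r Eur before-u-r
      in climb r (smaller r<u) r-trans r-reached
    ...   | tri≈ _ r≈u _ with pos-injective (∈-word r) (∈-word u) r≈u
    ...     | refl = not-¬ Eur (irref G u)

  transitive⇒not-vacant : ∀ {t} → Transitive G H t → ¬ Vacant G y t
  transitive⇒not-vacant {t} t-trans t-vacant =
    climb t-trans t-vacant t (<-wellFounded (outdeg t)) t-trans (inj₁ refl)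

proposition6p1 : (G : Graph) → NearComparability G → Permissible G
proposition6p1 G (H , near-transitive) =
  word , word-↭ , λ x → Fw-independent G x word-unique ∈-word
                      , nowhere-vacant⇒maximal G _ (not-vacant x)
  where
  open Ranking G H
  open Updates using (Fw-independent)

  not-vacant : ∀ x v → ¬ Vacant G (Fw G word x) v
  not-vacant x v v-vacant =
    let t , t-trans , N[t]⊆N[v] = near-transitive v
    in Domination.transitive⇒not-vacant G H x t-trans (λ s → v-vacant s ∘ N[t]⊆N[v] s)
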